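{- Let $G$ be a finite simple graph and $\Delta_T(G)$ its total simplicial complex. Then for every vertex $i$ of $\Delta_T(G)$, the link $\mathrm{link}_{\Delta_T(G)}(\{i\})$ is connected.
   Context: Total simplicial complex: for a finite simple graph $G$ with vertex set $[m]$ and edge set $E(G)$, the set of total indices $\Upsilon_T(G)$ is the collection of subsets of $[m]\cup E(G)$ consisting of the sets $\{p,q,r\}$ such that (i) $p,q,r$ are adjacent vertices in $G$; or (ii) $p,q,r$ are adjacent edges in $G$; or (iii) $p$ and $q$ are adjacent vertices and $r$ is an edge incident to $p$ or $q$; or (iv) $p$ and $q$ are adjacent edges and $r$ is a vertex incident to $p$ or $q$; together with the singletons $\{p\}$ for each isolated vertex $p$ of $G$. The total simplicial complex $\Delta_T(G)$ is the simplicial complex on vertex set $[m]\cup E(G)$ generated by the sets in $\Upsilon_T(G)$. For a simplicial complex $\Delta$ and face $\sigma$, $\mathrm{link}_\Delta(\sigma)=\{\tau\in\Delta : \tau\cap\sigma=\emptyset,\ \tau\cup\sigma\in\Delta\}$. A simplicial complex is connected if for any two facets $\sigma,\bar\sigma$ there is a sequence of facets $\sigma=\sigma_0,\ldots,\sigma_i=\bar\sigma$ with $\sigma_j\cap\sigma_{j+1}\neq\emptyset$ for all $j$. -}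

module Defs where

open import Data.Nat using (ℕ)
open import Data.Fin using (Fin; _<_)
open import Data.Bool using (Bool; T; false)
open import Data.Sum using (_⊎_)
open import Data.Product using (∃; _×_)
open import Data.List using (List; []; _∷_)
open import Data.List.Membership.Propositional using (_∈_; _∉_)
open import Data.List.Relation.Binary.Subset.Propositional using (_⊆_)
open import Relation.Binary.PropositionalEquality using (_≡_; _≢_)
open import Relation.Nullary using (¬_)

record SimpleGraph (m : ℕ) : Set where
  field
    adj        : Fin m → Fin m → Bool
    adj-sym    : ∀ i j → adj i j ≡ adj j i
    adj-irrefl : ∀ i → adj i i ≡ false

-- Generic notions for simplicial complexes given by a face predicate.
-- Faces are finite sets, represented by lists (order/repetition irrelevant:
-- all notions below only use membership).

module _ {A : Set} (Face : List A → Set) where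

  IsFacet : List A → Set
  IsFacet σ = Face σ × (∀ τ → Face τ → σ ⊆ τ → τ ⊆ σ)

  Meets : List A → List A → Set
  Meets σ τ = ∃ λ x → x ∈ σ × x ∈ τ

  data FacetChain : List A → List A → Set where
    done : ∀ {σ} → FacetChain σ σ
    step : ∀ {σ τ ρ} → IsFacet τ → Meets σ τ → FacetChain τ ρ → FacetChain σ ρ

  IsConnected : Set
  IsConnected = ∀ σ σ' → IsFacet σ → IsFacet σ' → FacetChain σ σ'

  Link : List A → List A → Set
  Link σ τ = Face τ × (∀ x → x ∈ τ → x ∉ σ) × Face (σ Data.List.++ τ)

module _ {m : ℕ} (G : SimpleGraph m) where
  open SimpleGraph G

  Adj : Fin m → Fin m → Set
  Adj i j = T (adj i j)

  -- an edge {u,v} of G, stored with u < v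
  record Edge : Set where
    constructor edge
    field
      u   : Fin m
      v   : Fin m
      u<v : u < v
      uv  : Adj u v

  Incident : Edge → Fin m → Set
  Incident e p = Edge.u e ≡ p ⊎ Edge.v e ≡ p

  AdjEdges : Edge → Edge → Set
  AdjEdges e f = e ≢ f × ∃ λ p → Incident e p × Incident f p

  Isolated : Fin m → Set
  Isolated p = ∀ q → ¬ Adj p q

  Elem : Set
  Elem = Fin m ⊎ Edge

  -- three distinct objects p,q,r are "adjacent" w.r.t. R:
  -- the graph R induces on {p,q,r} is connected
  Adjacent3 : {X : Set} → (X → X → Set) → X → X → X → Set
  Adjacent3 R p q r =
    (p ≢ q × q ≢ r × p ≢ r) ×
    ((R p q × R q r) ⊎ (R p q × R p r) ⊎ (R p r × R q r))

  data Gen : List Elem → Set where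
    vvv : ∀ p q r → Adjacent3 Adj p q r →
          Gen (_⊎_.inj₁ p ∷ _⊎_.inj₁ q ∷ _⊎_.inj₁ r ∷ [])
    eee : ∀ p q r → Adjacent3 AdjEdges p q r →
          Gen (_⊎_.inj₂ p ∷ _⊎_.inj₂ q ∷ _⊎_.inj₂ r ∷ [])
    vve : ∀ p q r → Adj p q → (Incident r p ⊎ Incident r q) →
          Gen (_⊎_.inj₁ p ∷ _⊎_.inj₁ q ∷ _⊎_.inj₂ r ∷ [])
    eev : ∀ p q r → AdjEdges p q → (Incident p r ⊎ Incident q r) →
          Gen (_⊎_.inj₂ p ∷ _⊎_.inj₂ q ∷ _⊎_.inj₁ r ∷ [])
    iso : ∀ p → Isolated p → Gen (_⊎_.inj₁ p ∷ [])

  TotalFace : List Elem → Set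
  TotalFace σ = ∃ λ g → Gen g × σ ⊆ g

-- Apart from isolated vertices, the generators of Δ_T(G) are exactly the triples that
-- are connected in the total graph T(G). Hence every facet σ of link({i}) either is empty
-- (i an isolated vertex, and then ∅ is the only facet) or contains a T(G)-neighbour x
-- of i, because σ ∪ {i} lies in a connected triple and facets absorb the rest of that
-- triple. For i = v a vertex, x lies in a facet {u, e} with u ~ v and e ∋ v, and any two
-- such facets {u, e}, {u', e'} are joined through {u, e'}. For i = e an edge, x is an
-- endpoint w of e or an edge f meeting e in w, and σ reaches the facet {endpoints of e}
-- directly or through {f, w}.
module Submission where

open import Defs
open import Data.Nat using (ℕ)
open import Data.Fin using (Fin)
open import Data.Fin.Properties using (<-cmp)
open import Data.List using (List; []; _∷_)
open import Data.List.Relation.Unary.Any using (here; there; _─_)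
open import Data.List.Membership.Propositional using (_∈_; _∉_)
open import Data.List.Relation.Binary.Subset.Propositional using (_⊆_)
open import Data.List.Relation.Binary.Subset.Propositional.Properties
  using (⊆[]⇒≡[]; xs⊆x∷xs; ∈-∷⁺ʳ)
open import Data.Sum using (_⊎_; inj₁; inj₂)
import Data.Sum as Sum
open import Data.Sum.Properties using (inj₁-injective; inj₂-injective)
open import Data.Product using (Σ; ∃; ∃₂; _×_; _,_; proj₁)
import Data.Product as Product
open import Data.Empty using (⊥-elim)
open import Data.Bool using (T)
open import Function using (_∘_)
open import Function.Definitions using (Injective)
open import Relation.Binary using (tri<; tri≈; tri>)
open import Relation.Binary.PropositionalEquality using (_≡_; _≢_; refl; sym; subst)
open import Relation.Nullary using (¬_)

module _ {A : Set} where

  ∈-─ : ∀ {i x : A} {xs} (p : i ∈ xs) → x ∈ xs → x ≢ i → x ∈ (xs ─ p)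
  ∈-─ (here refl) (here refl) x≢i = ⊥-elim (x≢i refl)
  ∈-─ (here _)    (there x∈)  _   = x∈
  ∈-─ (there _)   (here refl) _   = here refl
  ∈-─ (there p)   (there x∈)  x≢i = there (∈-─ p x∈ x≢i)

  pair-covered : ∀ {a b c d x : A} → a ∈ c ∷ d ∷ [] → b ∈ c ∷ d ∷ [] → a ≢ b →
                 x ∈ c ∷ d ∷ [] → x ∈ a ∷ b ∷ []
  pair-covered (here refl)         (here refl)         a≢b _ = ⊥-elim (a≢b refl)
  pair-covered (there (here refl)) (there (here refl)) a≢b _ = ⊥-elim (a≢b refl)
  pair-covered (here refl)         (there (here refl)) _   x∈ = x∈
  pair-covered (there (here refl)) (here refl)         _   (here refl)         = there (here refl)
  pair-covered (there (here refl)) (here refl)         _   (there (here refl)) = here refl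

  triple-covered : ∀ {c₁ c₂ c₃ i a b x : A} → let C = c₁ ∷ c₂ ∷ c₃ ∷ [] in
                   i ∈ C → a ∈ C → b ∈ C → i ≢ a → i ≢ b → a ≢ b →
                   x ∈ C → x ≢ i → x ∈ a ∷ b ∷ []
  triple-covered p@(here _) a∈ b∈ i≢a i≢b a≢b x∈ x≢i =
    pair-covered (∈-─ p a∈ (i≢a ∘ sym)) (∈-─ p b∈ (i≢b ∘ sym)) a≢b (∈-─ p x∈ x≢i)
  triple-covered p@(there (here _)) a∈ b∈ i≢a i≢b a≢b x∈ x≢i =
    pair-covered (∈-─ p a∈ (i≢a ∘ sym)) (∈-─ p b∈ (i≢b ∘ sym)) a≢b (∈-─ p x∈ x≢i)
  triple-covered p@(there (there (here _))) a∈ b∈ i≢a i≢b a≢b x∈ x≢i =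
    pair-covered (∈-─ p a∈ (i≢a ∘ sym)) (∈-─ p b∈ (i≢b ∘ sym)) a≢b (∈-─ p x∈ x≢i)

module _ {A : Set} {Face : List A → Set} where

  Meets-sym : ∀ {σ τ} → Meets Face σ τ → Meets Face τ σ
  Meets-sym (x , x∈σ , x∈τ) = x , x∈τ , x∈σ

  chain-trans : ∀ {σ τ ρ} → FacetChain Face σ τ → FacetChain Face τ ρ → FacetChain Face σ ρ
  chain-trans done           c′ = c′
  chain-trans (step f meet c) c′ = step f meet (chain-trans c c′)

  chain-sym : ∀ {σ τ} → IsFacet Face σ → FacetChain Face σ τ → FacetChain Face τ σ
  chain-sym fσ done            = done
  chain-sym fσ (step fτ meet c) = chain-trans (chain-sym fτ c) (step fσ (Meets-sym meet) done)

  empty-facet-unique : ∀ {σ} → IsFacet Face [] → IsFacet Face σ → σ ≡ []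
  empty-facet-unique (_ , maximal) (face , _) = ⊆[]⇒≡[] (maximal _ face (λ ()))

  empty-facet⇒chain : ∀ {σ σ′} → IsFacet Face [] → IsFacet Face σ → IsFacet Face σ′ →
                     FacetChain Face σ σ′
  empty-facet⇒chain f[] fσ fσ′
    rewrite empty-facet-unique f[] fσ | empty-facet-unique f[] fσ′ = done

  connected-via-hubs :
    (Hub : List A → Set) →
    (∀ {τ τ′} → Hub τ → Hub τ′ → FacetChain Face τ τ′) →
    (∀ {σ} → IsFacet Face σ → IsFacet Face [] ⊎ ∃ λ τ → Hub τ × FacetChain Face σ τ) →
    IsConnected Face
  connected-via-hubs Hub hubs-chained reach σ σ′ fσ fσ′ with reach fσ | reach fσ′
  ... | inj₁ f[] | _        = empty-facet⇒chain f[] fσ fσ′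
  ... | inj₂ _   | inj₁ f[] = empty-facet⇒chain f[] fσ fσ′
  ... | inj₂ (τ , hτ , c) | inj₂ (τ′ , hτ′ , c′) =
    chain-trans c (chain-trans (hubs-chained hτ hτ′) (chain-sym fσ′ c′))

module _ {m : ℕ} (G : SimpleGraph m) where
  open SimpleGraph G

  Adj-irrefl : ∀ {a} → ¬ Adj G a a
  Adj-irrefl {a} = subst T (adj-irrefl a)

  Adj-sym : ∀ {a b} → Adj G a b → Adj G b a
  Adj-sym {a} {b} = subst T (adj-sym a b)

  AdjEdges-sym : ∀ {e f} → AdjEdges G e f → AdjEdges G f e
  AdjEdges-sym (e≢f , w , e∋w , f∋w) = e≢f ∘ sym , w , f∋w , e∋w

  edge-between : ∀ {a b} → Adj G a b → Σ (Edge G) λ e → Incident G e a × Incident G e b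
  edge-between {a} {b} a~b with <-cmp a b
  ... | tri< a<b _ _ = edge a b a<b a~b , inj₁ refl , inj₂ refl
  ... | tri≈ _ refl _ = ⊥-elim (Adj-irrefl a~b)
  ... | tri> _ _ b<a = edge b a b<a (Adj-sym a~b) , inj₂ refl , inj₁ refl

  other-endpoint : ∀ {e v} → Incident G e v → ∃ λ u → Adj G v u
  other-endpoint {e} (inj₁ refl) = Edge.v e , Edge.uv e
  other-endpoint {e} (inj₂ refl) = Edge.u e , Adj-sym (Edge.uv e)

  data TotalAdj : Elem G → Elem G → Set where
    vertex-vertex : ∀ {u w} → Adj G u w → TotalAdj (inj₁ u) (inj₁ w)
    edge-edge     : ∀ {e f} → AdjEdges G e f → TotalAdj (inj₂ e) (inj₂ f)
    vertex-edge   : ∀ {u e} → Incident G e u → TotalAdj (inj₁ u) (inj₂ e)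
    edge-vertex   : ∀ {u e} → Incident G e u → TotalAdj (inj₂ e) (inj₁ u)

  TotalAdj-sym : ∀ {x y} → TotalAdj x y → TotalAdj y x
  TotalAdj-sym (vertex-vertex u~w) = vertex-vertex (Adj-sym u~w)
  TotalAdj-sym (edge-edge e~f)     = edge-edge (AdjEdges-sym e~f)
  TotalAdj-sym (vertex-edge e∋u)   = edge-vertex e∋u
  TotalAdj-sym (edge-vertex e∋u)   = vertex-edge e∋u

  TotalAdj-irrefl : ∀ {x y} → TotalAdj x y → x ≢ y
  TotalAdj-irrefl (vertex-vertex u~w) refl = Adj-irrefl u~w
  TotalAdj-irrefl (edge-edge (e≢f , _)) refl = e≢f refl

  Adjacent3-map : ∀ {X Y : Set} {R : X → X → Set} {S : Y → Y → Set} {p q r} (f : X → Y) →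
                  Injective _≡_ _≡_ f → (∀ {x y} → R x y → S (f x) (f y)) →
                  Adjacent3 G R p q r → Adjacent3 G S (f p) (f q) (f r)
  Adjacent3-map {R = R} {S} f f-inj R⇒S ((p≢q , q≢r , p≢r) , connected) =
    (p≢q ∘ f-inj , q≢r ∘ f-inj , p≢r ∘ f-inj) ,
    Sum.map both (Sum.map both both) connected
    where
    both : ∀ {a b c d} → R a b × R c d → S (f a) (f b) × S (f c) (f d)
    both = Product.map R⇒S R⇒S

  adjacent3-neighbour : ∀ {X : Set} {R : X → X → Set} {p q r x} →
                        (∀ {y z} → R y z → R z y) → Adjacent3 G R p q r →
                        x ∈ p ∷ q ∷ r ∷ [] → ∃ λ y → y ∈ p ∷ q ∷ r ∷ [] × R x y
  adjacent3-neighbour R-sym (_ , inj₁ (pq , qr)) (here refl) = _ , there (here refl) , pq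
  adjacent3-neighbour R-sym (_ , inj₁ (pq , qr)) (there (here refl)) =
    _ , here refl , R-sym pq
  adjacent3-neighbour R-sym (_ , inj₁ (pq , qr)) (there (there (here refl))) =
    _ , there (here refl) , R-sym qr
  adjacent3-neighbour R-sym (_ , inj₂ (inj₁ (pq , pr))) (here refl) = _ , there (here refl) , pq
  adjacent3-neighbour R-sym (_ , inj₂ (inj₁ (pq , pr))) (there (here refl)) =
    _ , here refl , R-sym pq
  adjacent3-neighbour R-sym (_ , inj₂ (inj₁ (pq , pr))) (there (there (here refl))) =
    _ , here refl , R-sym pr
  adjacent3-neighbour R-sym (_ , inj₂ (inj₂ (pr , qr))) (here refl) =
    _ , there (there (here refl)) , pr
  adjacent3-neighbour R-sym (_ , inj₂ (inj₂ (pr , qr))) (there (here refl)) =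
    _ , there (there (here refl)) , qr
  adjacent3-neighbour R-sym (_ , inj₂ (inj₂ (pr , qr))) (there (there (here refl))) =
    _ , here refl , R-sym pr

  triangle-connected : ∀ {a b c} → Gen G (a ∷ b ∷ c ∷ []) → Adjacent3 G TotalAdj a b c
  triangle-connected (vvv p q r adj3) =
    Adjacent3-map {S = TotalAdj} inj₁ inj₁-injective vertex-vertex adj3
  triangle-connected (eee p q r adj3) =
    Adjacent3-map {S = TotalAdj} inj₂ inj₂-injective edge-edge adj3
  triangle-connected (vve p q r p~q (inj₁ r∋p)) =
    ((λ { refl → Adj-irrefl p~q }) , (λ ()) , (λ ())) ,
    inj₂ (inj₁ (vertex-vertex p~q , vertex-edge r∋p))
  triangle-connected (vve p q r p~q (inj₂ r∋q)) =
    ((λ { refl → Adj-irrefl p~q }) , (λ ()) , (λ ())) ,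
    inj₁ (vertex-vertex p~q , vertex-edge r∋q)
  triangle-connected (eev p q r p~q (inj₁ p∋r)) =
    ((λ { refl → proj₁ p~q refl }) , (λ ()) , (λ ())) ,
    inj₂ (inj₁ (edge-edge p~q , edge-vertex p∋r))
  triangle-connected (eev p q r p~q (inj₂ q∋r)) =
    ((λ { refl → proj₁ p~q refl }) , (λ ()) , (λ ())) ,
    inj₁ (edge-edge p~q , edge-vertex q∋r)

  triangle-neighbour : ∀ {a b c x} → Gen G (a ∷ b ∷ c ∷ []) → x ∈ a ∷ b ∷ c ∷ [] →
                       ∃ λ y → y ∈ a ∷ b ∷ c ∷ [] × TotalAdj x y
  triangle-neighbour gen = adjacent3-neighbour TotalAdj-sym (triangle-connected gen)

  generator-total-neighbour : ∀ {g i} → Gen G g → i ∈ g →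
                              g ≡ i ∷ [] ⊎ ∃ λ x → x ∈ g × TotalAdj i x
  generator-total-neighbour (iso p _) (here refl) = inj₁ refl
  generator-total-neighbour gen@(vvv _ _ _ _)   = inj₂ ∘ triangle-neighbour gen
  generator-total-neighbour gen@(eee _ _ _ _)   = inj₂ ∘ triangle-neighbour gen
  generator-total-neighbour gen@(vve _ _ _ _ _) = inj₂ ∘ triangle-neighbour gen
  generator-total-neighbour gen@(eev _ _ _ _ _) = inj₂ ∘ triangle-neighbour gen

  generator-⊆-triple : ∀ {g} → Gen G g → ∃₂ λ c₁ c₂ → ∃ λ c₃ → g ⊆ c₁ ∷ c₂ ∷ c₃ ∷ []
  generator-⊆-triple (vvv _ _ _ _)   = _ , _ , _ , λ x∈ → x∈
  generator-⊆-triple (eee _ _ _ _)   = _ , _ , _ , λ x∈ → x∈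
  generator-⊆-triple (vve _ _ _ _ _) = _ , _ , _ , λ x∈ → x∈
  generator-⊆-triple (eev _ _ _ _ _) = _ , _ , _ , λ x∈ → x∈
  generator-⊆-triple (iso p _)       = inj₁ p , inj₁ p , inj₁ p , λ { (here refl) → here refl }

  LinkT : Elem G → List (Elem G) → Set
  LinkT i = Link (TotalFace G) (i ∷ [])

  pair-facet : ∀ {g i a b} → Gen G g → i ∈ g → a ∈ g → b ∈ g → i ≢ a → i ≢ b → a ≢ b →
               IsFacet (LinkT i) (a ∷ b ∷ [])
  pair-facet {g} {i} {a} {b} gen i∈ a∈ b∈ i≢a i≢b a≢b =
    ((g , gen , ab⊆g) , avoids-i , (g , gen , ∈-∷⁺ʳ i∈ ab⊆g)) , maximal
    where
    ab⊆g : a ∷ b ∷ [] ⊆ g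
    ab⊆g = ∈-∷⁺ʳ a∈ (∈-∷⁺ʳ b∈ (λ ()))

    avoids-i : ∀ x → x ∈ a ∷ b ∷ [] → x ∉ i ∷ []
    avoids-i _ (here refl)         (here a≡i) = i≢a (sym a≡i)
    avoids-i _ (there (here refl)) (here b≡i) = i≢b (sym b≡i)

    maximal : ∀ τ → LinkT i τ → a ∷ b ∷ [] ⊆ τ → τ ⊆ a ∷ b ∷ []
    maximal τ (_ , τ∌i , (g′ , gen′ , iτ⊆g′)) ab⊆τ x∈τ with generator-⊆-triple gen′
    ... | c₁ , c₂ , c₃ , g′⊆C =
      triple-covered (iτ⊆C (here refl)) (iτ⊆C (there (ab⊆τ (here refl))))
                     (iτ⊆C (there (ab⊆τ (there (here refl))))) i≢a i≢b a≢b
                     (iτ⊆C (there x∈τ)) (τ∌i _ x∈τ ∘ here)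
      where
      iτ⊆C : i ∷ τ ⊆ c₁ ∷ c₂ ∷ c₃ ∷ []
      iτ⊆C = g′⊆C ∘ iτ⊆g′

  facet-absorbs : ∀ {i σ g x} → IsFacet (LinkT i) σ → Gen G g → i ∷ σ ⊆ g →
                  x ∈ g → x ≢ i → x ∈ σ
  facet-absorbs {i} {σ} {g} {x} ((_ , σ∌i , _) , maximal) gen iσ⊆g x∈g x≢i =
    maximal (x ∷ σ) xσ-face (xs⊆x∷xs σ x) (here refl)
    where
    xσ∌i : ∀ y → y ∈ x ∷ σ → y ∉ i ∷ []
    xσ∌i _ (here refl) (here x≡i) = x≢i x≡i
    xσ∌i y (there y∈σ) = σ∌i y y∈σ

    xσ-face : LinkT i (x ∷ σ)
    xσ-face = (g , gen , ∈-∷⁺ʳ x∈g (iσ⊆g ∘ there)) , xσ∌i ,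
              (g , gen , ∈-∷⁺ʳ (iσ⊆g (here refl)) (∈-∷⁺ʳ x∈g (iσ⊆g ∘ there)))

  link-facet-empty-or-adjacent : ∀ {i σ} → IsFacet (LinkT i) σ →
                                 σ ≡ [] ⊎ ∃ λ x → x ∈ σ × TotalAdj i x
  link-facet-empty-or-adjacent fσ@((_ , σ∌i , (g , gen , iσ⊆g)) , _)
    with generator-total-neighbour gen (iσ⊆g (here refl))
  ... | inj₁ refl = inj₁ (⊆[]⇒≡[] (λ y∈σ → ⊥-elim (σ∌i _ y∈σ (iσ⊆g (there y∈σ)))))
  ... | inj₂ (x , x∈g , i~x) =
    inj₂ (x , facet-absorbs fσ gen iσ⊆g x∈g (TotalAdj-irrefl i~x ∘ sym) , i~x)

  link-connected : ∀ {i} (Hub : List (Elem G) → Set) →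
                   (∀ {τ τ′} → Hub τ → Hub τ′ → FacetChain (LinkT i) τ τ′) →
                   (∀ {σ x} → TotalAdj i x → x ∈ σ → ∃ λ τ → Hub τ × FacetChain (LinkT i) σ τ) →
                   IsConnected (LinkT i)
  link-connected Hub hubs-chained reach-hub = connected-via-hubs Hub hubs-chained reach
    where
    reach : ∀ {σ} → IsFacet _ σ → IsFacet _ [] ⊎ ∃ λ τ → Hub τ × FacetChain _ σ τ
    reach fσ with link-facet-empty-or-adjacent fσ
    ... | inj₁ refl = inj₁ fσ
    ... | inj₂ (x , x∈σ , i~x) = inj₂ (reach-hub i~x x∈σ)

  data Star (v : Fin m) : List (Elem G) → Set where
    star : ∀ {u e} → Adj G v u → Incident G e v → Star v (inj₁ u ∷ inj₂ e ∷ [])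

  star-facet : ∀ {v τ} → Star v τ → IsFacet (LinkT (inj₁ v)) τ
  star-facet (star {u} {e} v~u e∋v) =
    pair-facet (vve _ u e v~u (inj₁ e∋v)) (here refl) (there (here refl))
               (there (there (here refl))) (λ { refl → Adj-irrefl v~u }) (λ ()) (λ ())

  stars-chained : ∀ {v τ τ′} → Star v τ → Star v τ′ → FacetChain (LinkT (inj₁ v)) τ τ′
  stars-chained (star {u} v~u _) s′@(star {e = e′} _ e′∋v) =
    step (star-facet (star v~u e′∋v)) (inj₁ u , here refl , here refl)
      (step (star-facet s′) (inj₂ e′ , there (here refl) , there (here refl)) done)

  total-neighbour-in-star : ∀ {v x} → TotalAdj (inj₁ v) x → ∃ λ τ → Star v τ × x ∈ τ
  total-neighbour-in-star (vertex-vertex {w = u} v~u) with edge-between v~u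
  ... | e , e∋v , _ = _ , star {u = u} {e} v~u e∋v , here refl
  total-neighbour-in-star {v} (vertex-edge {e = e} e∋v) with other-endpoint {e} {v} e∋v
  ... | u , v~u = _ , star {u = u} {e} v~u e∋v , there (here refl)

  vertex-link-connected : ∀ v → IsConnected (LinkT (inj₁ v))
  vertex-link-connected v = link-connected (Star v) stars-chained reach-star
    where
    reach-star : ∀ {σ x} → TotalAdj (inj₁ v) x → x ∈ σ →
                 ∃ λ τ → Star v τ × FacetChain (LinkT (inj₁ v)) σ τ
    reach-star v~x x∈σ with total-neighbour-in-star v~x
    ... | τ , s , x∈τ = τ , s , step (star-facet s) (_ , x∈σ , x∈τ) done

  endpoints : Edge G → List (Elem G)
  endpoints e = inj₁ (Edge.u e) ∷ inj₁ (Edge.v e) ∷ []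

  endpoints-facet : ∀ e → IsFacet (LinkT (inj₂ e)) (endpoints e)
  endpoints-facet e =
    pair-facet (vve _ _ e (Edge.uv e) (inj₁ (inj₁ refl))) (there (there (here refl)))
               (here refl) (there (here refl))
               (λ ()) (λ ()) (λ { refl → Adj-irrefl (Edge.uv e) })

  endpoint-∈ : ∀ {e w} → Incident G e w → inj₁ w ∈ endpoints e
  endpoint-∈ (inj₁ refl) = here refl
  endpoint-∈ (inj₂ refl) = there (here refl)

  chain-to-endpoints : ∀ {e σ x} → TotalAdj (inj₂ e) x → x ∈ σ →
                       FacetChain (LinkT (inj₂ e)) σ (endpoints e)
  chain-to-endpoints {e} (edge-vertex {w} e∋w) x∈σ =
    step (endpoints-facet e) (inj₁ w , x∈σ , endpoint-∈ {e} e∋w) done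
  chain-to-endpoints {e} (edge-edge {f = f} e~f@(e≢f , w , e∋w , _)) x∈σ =
    step (pair-facet (eev e f w e~f (inj₁ e∋w)) (here refl) (there (here refl))
                     (there (there (here refl))) (λ { refl → e≢f refl }) (λ ()) (λ ()))
         (_ , x∈σ , here refl)
         (step (endpoints-facet e) (inj₁ w , there (here refl) , endpoint-∈ {e} e∋w) done)

  edge-link-connected : ∀ e → IsConnected (LinkT (inj₂ e))
  edge-link-connected e =
    link-connected (_≡ endpoints e) (λ { refl refl → done })
                   (λ e~x x∈σ → endpoints e , refl , chain-to-endpoints e~x x∈σ)

lemma3p2 : ∀ {m : ℕ} (G : SimpleGraph m) (i : Elem G) →
           TotalFace G (i ∷ []) →
           IsConnected (Link (TotalFace G) (i ∷ []))
lemma3p2 G (inj₁ v) _ = vertex-link-connected G v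
lemma3p2 G (inj₂ e) _ = edge-link-connected G e
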